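{- If a graph $G$ has a weak tree-decomposition $(B_x:x\in V(T))$ with width $k$, then $G$ has a tree-decomposition $(B'_x:x\in V(T))$ (indexed by the same tree $T$) with width at most $2k+1$. Moreover, if $(B_x:x\in V(T))$ is slick, then $(B'_x:x\in V(T))$ is slick (with respect to the same rooting of $T$).
   Context: Graphs are simple, undirected and finite. For a non-empty tree $T$, a $T$-decomposition of $G$ is a collection $(B_x:x\in V(T))$ of subsets of $V(G)$ such that each edge of $G$ has both ends in some $B_x$ and for each $v\in V(G)$ the set $\{x:v\in B_x\}$ induces a non-empty connected subtree of $T$. A weak $T$-decomposition is defined the same way except that the edge condition is replaced by: for each edge $vw\in E(G)$ there is an edge $xy\in E(T)$ with $v,w\in B_x\cup B_y$. Width is $\max_x|B_x|-1$ in both cases. A (weak) tree-decomposition is rooted if $T$ is rooted, and a rooted one is slick if for each edge $xy\in E(T)$ with $x$ the parent of $y$, and each $v\in B_x\cap B_y$, we have $(N_G(v)\cap B_y)\setminus B_x\neq\emptyset$. -}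

module Defs where

open import Data.Nat using (ℕ; zero; suc; _+_; _*_; _≤_; _<_)
open import Data.Fin using (Fin; zero; suc; inject₁; fromℕ)
open import Data.Fin.Subset using (Subset; _∈_; _∉_; _∪_; ∣_∣)
open import Data.Product using (Σ; ∃; ∃-syntax; _×_; _,_)
open import Data.Unit using (⊤)
open import Data.Empty using (⊥)
open import Relation.Nullary using (¬_)
open import Relation.Binary using (Decidable)
open import Relation.Binary.PropositionalEquality using (_≡_)
open import Function.Definitions using (Injective)

record Graph : Set₁ where
  field
    n     : ℕ
    Adj   : Fin n → Fin n → Set
    adj?  : Decidable Adj
    sym   : ∀ {u v} → Adj u v → Adj v u
    irrefl : ∀ {u} → ¬ Adj u u

open Graph public

data Walk (G : Graph) (P : Fin (n G) → Set) : Fin (n G) → Fin (n G) → Set where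
  here : ∀ {a} → P a → Walk G P a a
  step : ∀ {a b c} → P a → Adj G a b → Walk G P b c → Walk G P a c

Connected : Graph → Set
Connected G = ∀ a b → Walk G (λ _ → ⊤) a b

record Cycle (G : Graph) : Set where
  field
    l    : ℕ
    c    : Fin (3 + l) → Fin (n G)
    inj  : Injective _≡_ _≡_ c
    adjs : ∀ (i : Fin (2 + l)) → Adj G (c (inject₁ i)) (c (suc i))
    close : Adj G (c (fromℕ (2 + l))) (c zero)

IsTree : Graph → Set
IsTree T = (0 < n T) × Connected T × ¬ Cycle T

Bags : Graph → Graph → Set
Bags G T = Fin (n T) → Subset (n G)

SubtreeCond : (G T : Graph) → Bags G T → Set
SubtreeCond G T B =
  ∀ v → (∃[ x ] v ∈ B x) × (∀ x y → v ∈ B x → v ∈ B y → Walk T (λ z → v ∈ B z) x y)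

IsTreeDecomposition : (G T : Graph) → Bags G T → Set
IsTreeDecomposition G T B =
  (∀ v w → Adj G v w → ∃[ x ] (v ∈ B x × w ∈ B x)) × SubtreeCond G T B

IsWeakTreeDecomposition : (G T : Graph) → Bags G T → Set
IsWeakTreeDecomposition G T B =
  (∀ v w → Adj G v w →
     ∃[ x ] ∃[ y ] (Adj T x y × v ∈ (B x ∪ B y) × w ∈ (B x ∪ B y)))
  × SubtreeCond G T B

HasWidth : (G T : Graph) → Bags G T → ℕ → Set
HasWidth G T B k = (∀ x → ∣ B x ∣ ≤ suc k) × (∃[ x ] ∣ B x ∣ ≡ suc k)

WidthAtMost : (G T : Graph) → Bags G T → ℕ → Set
WidthAtMost G T B k = ∀ x → ∣ B x ∣ ≤ suc k

-- In T rooted at r, x is the parent of y: xy is an edge and x is joined to r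
-- by a path avoiding y (in a tree this says x lies on the y–r path).
Parent : (T : Graph) → Fin (n T) → Fin (n T) → Fin (n T) → Set
Parent T r x y = Adj T x y × Walk T (λ z → ¬ z ≡ y) x r

Slick : (G T : Graph) → Fin (n T) → Bags G T → Set
Slick G T r B =
  ∀ x y → Parent T r x y → ∀ v → v ∈ B x → v ∈ B y →
    ∃[ w ] (Adj G v w × w ∈ B y × w ∉ B x)

-- Root T at r and, for every other node y with parent x, add to B y the vertices
-- of B x that have a neighbour in B y ∖ B x.  An edge that the weak decomposition
-- only covers across the tree edge xy then lies in the new bag at x or at y;
-- every added occurrence of a vertex sits next to an old occurrence at the
-- parent, so occurrences stay connected; and a new bag has at most
-- |B y| + |B x| ≤ 2k + 2 elements.  Slickness survives because a vertex added to
-- the bag at x comes from the parent of x, so by the subtree property it cannot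
-- lie in B y for a child y of x without lying in B x already.
module Submission where

open import Defs
open import Data.Nat using (ℕ; _+_; _*_; _≤_; z≤n; s≤s; suc; zero)
open import Data.Nat.Properties
  using (≤-trans; +-monoʳ-≤; +-mono-≤; n≤1+n; +-suc; +-comm; +-identityʳ; m≤m+n; module ≤-Reasoning)
open import Data.Fin using (Fin; zero; suc; inject₁; fromℕ; _≟_)
open import Data.Fin.Subset using (Subset; _∈_; _∉_; _∪_; _⊆_; ∣_∣; inside; outside)
open import Data.Fin.Subset.Properties using (_∈?_; x∈p∪q⁻; x∈p∪q⁺; p⊆q⇒∣p∣≤∣q∣)
open import Data.Fin.Properties using (any?)
open import Data.Vec using (_∷_; []; tabulate)
open import Data.Vec.Properties using (lookup∘tabulate; []=⇒lookup; lookup⇒[]=)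
open import Data.Product using (Σ; ∃-syntax; _×_; _,_; proj₁; proj₂)
open import Data.Sum using (_⊎_; inj₁; inj₂; [_,_]′; swap)
open import Data.Unit using (⊤; tt)
open import Data.Empty using (⊥-elim)
open import Function using (_∘_)
open import Relation.Nullary using (¬_; Dec; yes; no; does; proof)
open import Relation.Nullary.Reflects using (Reflects; invert)
open import Relation.Nullary.Decidable using (_×-dec_; ¬?; dec-true)
open import Relation.Unary using (Decidable)
open import Relation.Binary.PropositionalEquality
  using (_≡_; _≢_; refl; subst; cong; trans; module ≡-Reasoning)
  renaming (sym to ≡-sym)

∣p∪q∣≤∣p∣+∣q∣ : ∀ {m} (p q : Subset m) → ∣ p ∪ q ∣ ≤ ∣ p ∣ + ∣ q ∣
∣p∪q∣≤∣p∣+∣q∣ []            []            = z≤n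
∣p∪q∣≤∣p∣+∣q∣ (inside  ∷ p) (inside  ∷ q) =
  s≤s (≤-trans (∣p∪q∣≤∣p∣+∣q∣ p q) (+-monoʳ-≤ ∣ p ∣ (n≤1+n ∣ q ∣)))
∣p∪q∣≤∣p∣+∣q∣ (inside  ∷ p) (outside ∷ q) = s≤s (∣p∪q∣≤∣p∣+∣q∣ p q)
∣p∪q∣≤∣p∣+∣q∣ (outside ∷ p) (inside  ∷ q) rewrite +-suc ∣ p ∣ ∣ q ∣ = s≤s (∣p∪q∣≤∣p∣+∣q∣ p q)
∣p∪q∣≤∣p∣+∣q∣ (outside ∷ p) (outside ∷ q) = ∣p∪q∣≤∣p∣+∣q∣ p q

module _ {m} {P : Fin m → Set} (P? : Decidable P) where

  subsetOf : Subset m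
  subsetOf = tabulate (does ∘ P?)

  ∈-subsetOf⁺ : ∀ {v} → P v → v ∈ subsetOf
  ∈-subsetOf⁺ {v} pv = lookup⇒[]= v subsetOf (trans (lookup∘tabulate _ v) (dec-true (P? v) pv))

  ∈-subsetOf⁻ : ∀ {v} → v ∈ subsetOf → P v
  ∈-subsetOf⁻ {v} v∈ = invert (subst (Reflects (P v)) does≡inside (proof (P? v)))
    where
    does≡inside : does (P? v) ≡ inside
    does≡inside = trans (≡-sym (lookup∘tabulate _ v)) ([]=⇒lookup v∈)

suc-k+suc-k≡suc[2k+1] : ∀ k → suc k + suc k ≡ suc (2 * k + 1)
suc-k+suc-k≡suc[2k+1] k = cong suc (begin
  k + suc k        ≡⟨ +-suc k k ⟩
  suc (k + k)      ≡⟨ +-comm 1 (k + k) ⟩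
  k + k + 1        ≡⟨ cong (λ j → k + j + 1) (≡-sym (+-identityʳ k)) ⟩
  2 * k + 1        ∎)
  where open ≡-Reasoning

module Walks (G : Graph) where

  private
    V : Set
    V = Fin (n G)

    variable
      P Q : V → Set
      a b c x z : V

  first : Walk G P a b → P a
  first (here p)     = p
  first (step p _ _) = p

  last : Walk G P a b → P b
  last (here p)     = p
  last (step _ _ W) = last W

  map : (∀ {v} → P v → Q v) → Walk G P a b → Walk G Q a b
  map f (here p)     = here (f p)
  map f (step p e W) = step (f p) e (map f W)

  _++_ : Walk G P a b → Walk G P b c → Walk G P a c
  here _     ++ W′ = W′
  step p e W ++ W′ = step p e (W ++ W′)

  reverse : Walk G P a b → Walk G P b a
  reverse (here p)     = here p
  reverse (step p e W) = reverse W ++ step (first W) (sym G e) (here p)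

  Avoiding : (V → Set) → V → V → Set
  Avoiding P x v = P v × v ≢ x

  split-at-last-visit : ∀ x → Walk G P a b → x ≢ b →
    Walk G (Avoiding P x) a b ⊎ P x × ∃[ d ] Adj G x d × Walk G (Avoiding P x) d b
  split-at-last-visit x (here p) x≢b = inj₁ (here (p , x≢b ∘ ≡-sym))
  split-at-last-visit x (step {a} p e W) x≢b with split-at-last-visit x W x≢b
  ... | inj₂ exit = inj₂ exit
  ... | inj₁ W′ with a ≟ x
  ...   | yes refl = inj₂ (p , _ , e , W′)
  ...   | no a≢x   = inj₁ (step (p , a≢x) e W′)

  adjacent-distinct : Adj G a b → a ≢ b
  adjacent-distinct a~b refl = irrefl G a~b

  _∈ᵥ_ : V → Walk G P a b → Set
  x ∈ᵥ here {a} _     = x ≡ a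
  x ∈ᵥ step {a} _ _ W = x ≡ a ⊎ x ∈ᵥ W

  _∈ᵥ?_ : ∀ x (W : Walk G P a b) → Dec (x ∈ᵥ W)
  x ∈ᵥ? here {a} _ = x ≟ a
  x ∈ᵥ? step {a} _ _ W with x ≟ a | x ∈ᵥ? W
  ... | yes x≡a | _        = yes (inj₁ x≡a)
  ... | no _    | yes x∈W  = yes (inj₂ x∈W)
  ... | no x≢a  | no x∉W   = no [ x≢a , x∉W ]′

  Simple : Walk G P a b → Set
  Simple (here _)         = ⊤
  Simple (step {a} _ _ W) = ¬ a ∈ᵥ W × Simple W

  SimpleWalk : (V → Set) → V → V → Set
  SimpleWalk P a b = Σ (Walk G P a b) Simple

  suffix : (W : Walk G P a b) → Simple W → x ∈ᵥ W → SimpleWalk P x b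
  suffix (here p)     _       refl       = here p , tt
  suffix (step p e W) simple  (inj₁ refl) = step p e W , simple
  suffix (step p e W) (_ , s) (inj₂ x∈W)  = suffix W s x∈W

  shortcut : Walk G P a b → SimpleWalk P a b
  shortcut (here p) = here p , tt
  shortcut (step {a} p e W) with shortcut W
  ... | W′ , s with a ∈ᵥ? W′
  ...   | yes a∈W′ = suffix W′ s a∈W′
  ...   | no a∉W′  = step p e W′ , a∉W′ , s

  length : Walk G P a b → ℕ
  length (here _)     = zero
  length (step _ _ W) = suc (length W)

  vertex : (W : Walk G P a b) → Fin (suc (length W)) → V
  vertex (here {a} _)     zero    = a
  vertex (step {a} _ _ W) zero    = a
  vertex (step _ _ W)     (suc i) = vertex W i

  vertex-∈ᵥ : (W : Walk G P a b) → ∀ i → vertex W i ∈ᵥ W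
  vertex-∈ᵥ (here _)     zero    = refl
  vertex-∈ᵥ (step _ _ W) zero    = inj₁ refl
  vertex-∈ᵥ (step _ _ W) (suc i) = inj₂ (vertex-∈ᵥ W i)

  vertex-satisfies : (W : Walk G P a b) → ∀ i → P (vertex W i)
  vertex-satisfies (here p)     zero    = p
  vertex-satisfies (step p _ W) zero    = p
  vertex-satisfies (step _ _ W) (suc i) = vertex-satisfies W i

  vertex-zero : (W : Walk G P a b) → vertex W zero ≡ a
  vertex-zero (here _)     = refl
  vertex-zero (step _ _ _) = refl

  vertex-last : (W : Walk G P a b) → vertex W (fromℕ (length W)) ≡ b
  vertex-last (here _)     = refl
  vertex-last (step _ _ W) = vertex-last W

  vertex-adjacent : (W : Walk G P a b) (i : Fin (length W)) →
                    Adj G (vertex W (inject₁ i)) (vertex W (suc i))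
  vertex-adjacent (step _ e W) zero    = subst (Adj G _) (≡-sym (vertex-zero W)) e
  vertex-adjacent (step _ _ W) (suc i) = vertex-adjacent W i

  vertex-injective : (W : Walk G P a b) → Simple W → ∀ i j → vertex W i ≡ vertex W j → i ≡ j
  vertex-injective (here _)     _         zero    zero    _  = refl
  vertex-injective (step _ _ W) _         zero    zero    _  = refl
  vertex-injective (step _ _ W) (a∉W , _) zero    (suc j) eq =
    ⊥-elim (a∉W (subst (_∈ᵥ W) (≡-sym eq) (vertex-∈ᵥ W j)))
  vertex-injective (step _ _ W) (a∉W , _) (suc i) zero    eq =
    ⊥-elim (a∉W (subst (_∈ᵥ W) eq (vertex-∈ᵥ W i)))
  vertex-injective (step _ _ W) (_ , s)   (suc i) (suc j) eq = cong suc (vertex-injective W s i j eq)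

  cycle-via-common-neighbour : (W : Walk G (_≢ z) a b) → Simple W → a ≢ b → Adj G z a → Adj G z b → Cycle G
  cycle-via-common-neighbour (here _) _ a≢b _ _ = ⊥-elim (a≢b refl)
  cycle-via-common-neighbour {z} W@(step _ _ W₁) simple _ za zb = record
    { l     = length W₁
    ; c     = around
    ; inj   = λ {i} {j} → around-injective i j
    ; adjs  = around-adjacent
    ; close = subst (λ t → Adj G t z) (≡-sym (vertex-last W)) (sym G zb)
    }
    where
    around : Fin (3 + length W₁) → V
    around zero    = z
    around (suc i) = vertex W i

    around-injective : ∀ i j → around i ≡ around j → i ≡ j
    around-injective zero    zero    _  = refl
    around-injective zero    (suc j) eq = ⊥-elim (vertex-satisfies W j (≡-sym eq))
    around-injective (suc i) zero    eq = ⊥-elim (vertex-satisfies W i eq)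
    around-injective (suc i) (suc j) eq = cong suc (vertex-injective W simple i j eq)

    around-adjacent : ∀ (i : Fin (2 + length W₁)) → Adj G (around (inject₁ i)) (around (suc i))
    around-adjacent zero    = za
    around-adjacent (suc i) = vertex-adjacent W i

  acyclic⇒neighbours-separated : ¬ Cycle G → Adj G z a → Adj G z b → a ≢ b →
                                  ¬ Walk G (_≢ z) a b
  acyclic⇒neighbours-separated acyclic za zb a≢b W =
    let W′ , simple = shortcut W in acyclic (cycle-via-common-neighbour W′ simple a≢b za zb)

module RootedTree (T : Graph) (tree : IsTree T) (r : Fin (n T)) where
  open Walks T

  private
    V : Set
    V = Fin (n T)

    variable
      P : V → Set
      a b p x x′ y z : V

    connected : Connected T
    connected = proj₁ (proj₂ tree)

    separated : Adj T z a → Adj T z b → a ≢ b → ¬ Walk T (_≢ z) a b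
    separated = acyclic⇒neighbours-separated (proj₂ (proj₂ tree))

  root-or-child : ∀ y → y ≡ r ⊎ ∃[ x ] Parent T r x y
  root-or-child y with y ≟ r
  ... | yes y≡r = inj₁ y≡r
  ... | no y≢r with split-at-last-visit y (connected y r) y≢r
  ...   | inj₁ W                = ⊥-elim (proj₂ (first W) refl)
  ...   | inj₂ (_ , x , e , W) = inj₂ (x , sym T e , map proj₂ W)

  child≢root : Parent T r x y → y ≢ r
  child≢root (_ , W) y≡r = last W (≡-sym y≡r)

  parent-unique : Parent T r x y → Parent T r x′ y → x ≡ x′
  parent-unique {x} {y} {x′} (e , W) (e′ , W′) with x ≟ x′
  ... | yes x≡x′ = x≡x′
  ... | no x≢x′  = ⊥-elim (separated (sym T e) (sym T e′) x≢x′ (W ++ reverse W′))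

  parent-asymmetric : Parent T r x y → ¬ Parent T r y x
  parent-asymmetric {x} {y} (x~y , Wx) (_ , Wy) with split-at-last-visit x Wx (last Wy ∘ ≡-sym)
  ... | inj₁ W                  = proj₂ (first W) refl
  ... | inj₂ (_ , d , x~d , W) =
        separated x~d x~y (proj₁ (first W)) (map proj₂ W ++ reverse Wy)

  orient : Adj T x y → Parent T r x y ⊎ Parent T r y x
  orient {x} {y} x~y with y ≟ r | x ≟ r
  ... | yes refl | _        = inj₂ (sym T x~y , here (adjacent-distinct (sym T x~y)))
  ... | no y≢r   | yes refl = inj₁ (x~y , here (y≢r ∘ ≡-sym))
  ... | no y≢r   | no x≢r   with split-at-last-visit x (connected x r) x≢r
  ...   | inj₁ W                  = ⊥-elim (proj₂ (first W) refl)
  ...   | inj₂ (_ , c , x~c , W₁) with split-at-last-visit y W₁ y≢r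
  ...     | inj₁ W₂ =
            inj₁ (x~y , step (adjacent-distinct x~y) x~c (map proj₂ W₂))
  ...     | inj₂ (_ , d , y~d , W₃) =
            inj₂ (sym T x~y , step (adjacent-distinct (sym T x~y)) y~d (map (proj₂ ∘ proj₁) W₃))

  parent-on-walk : Parent T r p x → Parent T r x y → Walk T P p y → P x
  parent-on-walk {p} {x} {y} p→x x→y W
    with split-at-last-visit x W (adjacent-distinct (proj₁ x→y))
  ... | inj₂ (Px , _) = Px
  ... | inj₁ W′ = ⊥-elim (separated (sym T (proj₁ p→x)) (proj₁ x→y) p≢y (map proj₂ W′))
    where
    p≢y : p ≢ y
    p≢y refl = parent-asymmetric x→y p→x

module Strengthening (G T : Graph) (tree : IsTree T) (B : Bags G T)
                     (weak : IsWeakTreeDecomposition G T B) (r : Fin (n T)) where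
  open Walks T
  open RootedTree T tree r

  private
    V : Set
    V = Fin (n T)

    variable
      u v w : Fin (n G)
      x y : V

    subtree : SubtreeCond G T B
    subtree = proj₂ weak

  Escapes : Bags G T → V → V → Fin (n G) → Set
  Escapes C x y v = ∃[ w ] Adj G v w × w ∈ C y × w ∉ C x

  Boundary : V → V → Fin (n G) → Set
  Boundary x y v = v ∈ B x × Escapes B x y v

  boundary? : ∀ x y → Decidable (Boundary x y)
  boundary? x y v = (v ∈? B x) ×-dec any? λ w → adj? G v w ×-dec (w ∈? B y) ×-dec ¬? (w ∈? B x)

  boundary : V → V → Subset (n G)
  boundary x y = subsetOf (boundary? x y)

  bag : ∀ y → y ≡ r ⊎ ∃[ x ] Parent T r x y → Subset (n G)
  bag y (inj₁ _)       = B y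
  bag y (inj₂ (x , _)) = B y ∪ boundary x y

  B⁺ : Bags G T
  B⁺ y = bag y (root-or-child y)

  B⊆B⁺ : B y ⊆ B⁺ y
  B⊆B⁺ {y} = B⊆bag (root-or-child y)
    where
    B⊆bag : ∀ o → B y ⊆ bag y o
    B⊆bag (inj₁ _) v∈ = v∈
    B⊆bag (inj₂ _) v∈ = x∈p∪q⁺ (inj₁ v∈)

  Boundary⊆B⁺ : Parent T r x y → Boundary x y v → v ∈ B⁺ y
  Boundary⊆B⁺ {x} {y} {v} x→y bd = Boundary⊆bag (root-or-child y)
    where
    Boundary⊆bag : ∀ o → v ∈ bag y o
    Boundary⊆bag (inj₁ y≡r)          = ⊥-elim (child≢root x→y y≡r)
    Boundary⊆bag (inj₂ (x′ , x′→y)) = x∈p∪q⁺ (inj₂ (∈-subsetOf⁺ (boundary? x′ y)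
      (subst (λ t → Boundary t y v) (≡-sym (parent-unique x′→y x→y)) bd)))

  B⁺-cases : v ∈ B⁺ y → v ∈ B y ⊎ ∃[ x ] Parent T r x y × Boundary x y v
  B⁺-cases {v} {y} = bag-cases (root-or-child y)
    where
    bag-cases : ∀ o → v ∈ bag y o → v ∈ B y ⊎ ∃[ x ] Parent T r x y × Boundary x y v
    bag-cases (inj₁ _)            v∈ = inj₁ v∈
    bag-cases (inj₂ (x , x→y)) v∈ with x∈p∪q⁻ (B y) (boundary x y) v∈
    ... | inj₁ v∈B  = inj₁ v∈B
    ... | inj₂ v∈bd = inj₂ (x , x→y , ∈-subsetOf⁻ (boundary? x y) v∈bd)

  Covered : Fin (n G) → Fin (n G) → Set
  Covered v w = ∃[ t ] v ∈ B⁺ t × w ∈ B⁺ t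

  cross-edge-covered : Parent T r x y → v ∈ B x → w ∈ B y → Adj G v w → Covered v w
  cross-edge-covered {x} {y} {w = w} x→y v∈x w∈y v~w with w ∈? B x
  ... | yes w∈x = x , B⊆B⁺ v∈x , B⊆B⁺ w∈x
  ... | no w∉x  = y , Boundary⊆B⁺ x→y (v∈x , w , v~w , w∈y , w∉x) , B⊆B⁺ w∈y

  edge-across-covered : Parent T r x y → v ∈ B x ⊎ v ∈ B y → w ∈ B x ⊎ w ∈ B y →
                        Adj G v w → Covered v w
  edge-across-covered {x} x→y (inj₁ v∈x) (inj₁ w∈x) _ = x , B⊆B⁺ v∈x , B⊆B⁺ w∈x
  edge-across-covered {y = y} x→y (inj₂ v∈y) (inj₂ w∈y) _ = y , B⊆B⁺ v∈y , B⊆B⁺ w∈y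
  edge-across-covered x→y (inj₁ v∈x) (inj₂ w∈y) v~w = cross-edge-covered x→y v∈x w∈y v~w
  edge-across-covered x→y (inj₂ v∈y) (inj₁ w∈x) v~w =
    let t , w∈t , v∈t = cross-edge-covered x→y w∈x v∈y (sym G v~w) in t , v∈t , w∈t

  B⁺-covers : ∀ v w → Adj G v w → Covered v w
  B⁺-covers v w v~w with proj₁ weak v w v~w
  ... | x , y , x~y , v∈ , w∈ with orient x~y | x∈p∪q⁻ (B x) (B y) v∈ | x∈p∪q⁻ (B x) (B y) w∈
  ...   | inj₁ x→y | v∈xy | w∈xy = edge-across-covered x→y v∈xy w∈xy v~w
  ...   | inj₂ y→x | v∈xy | w∈xy = edge-across-covered y→x (swap v∈xy) (swap w∈xy) v~w

  reaches-B : v ∈ B⁺ x → ∃[ x₀ ] v ∈ B x₀ × Walk T (λ t → v ∈ B⁺ t) x x₀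
  reaches-B {x = x} v∈x with B⁺-cases v∈x
  ... | inj₁ v∈Bx                  = x , v∈Bx , here v∈x
  ... | inj₂ (p , p→x , v∈Bp , _) = p , v∈Bp , step v∈x (sym T (proj₁ p→x)) (here (B⊆B⁺ v∈Bp))

  B⁺-occurrences-connected : ∀ x y → v ∈ B⁺ x → v ∈ B⁺ y → Walk T (λ t → v ∈ B⁺ t) x y
  B⁺-occurrences-connected {v} _ _ v∈x v∈y with reaches-B v∈x | reaches-B v∈y
  ... | x₀ , v∈x₀ , Wx | y₀ , v∈y₀ , Wy =
    Wx ++ (map B⊆B⁺ (proj₂ (subtree v) x₀ y₀ v∈x₀ v∈y₀) ++ reverse Wy)

  B⁺-subtree : SubtreeCond G T B⁺
  B⁺-subtree v = let x , v∈x = proj₁ (subtree v) in (x , B⊆B⁺ v∈x) , B⁺-occurrences-connected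

  B⁺-width : ∀ {k} → WidthAtMost G T B k → WidthAtMost G T B⁺ (2 * k + 1)
  B⁺-width {k} width y =
    subst (∣ B⁺ y ∣ ≤_) (suc-k+suc-k≡suc[2k+1] k) (bag-size (root-or-child y))
    where
    open ≤-Reasoning

    bag-size : ∀ o → ∣ bag y o ∣ ≤ suc k + suc k
    bag-size (inj₁ _)       = ≤-trans (width y) (m≤m+n (suc k) (suc k))
    bag-size (inj₂ (x , _)) = begin
      ∣ B y ∪ boundary x y ∣      ≤⟨ ∣p∪q∣≤∣p∣+∣q∣ (B y) (boundary x y) ⟩
      ∣ B y ∣ + ∣ boundary x y ∣  ≤⟨ +-mono-≤ (width y) (≤-trans (p⊆q⇒∣p∣≤∣q∣ boundary⊆B) (width x)) ⟩
      suc k + suc k               ∎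
      where
      boundary⊆B : boundary x y ⊆ B x
      boundary⊆B = proj₁ ∘ ∈-subsetOf⁻ (boundary? x y)

  B⁺∩B-child⊆B : Parent T r x y → u ∈ B⁺ x → u ∈ B y → u ∈ B x
  B⁺∩B-child⊆B {y = y} {u = u} x→y u∈x u∈y with B⁺-cases u∈x
  ... | inj₁ u∈Bx                  = u∈Bx
  ... | inj₂ (p , p→x , u∈Bp , _) = parent-on-walk p→x x→y (proj₂ (subtree u) p y u∈Bp u∈y)

  Escapes⇒Escapes⁺ : Parent T r x y → Escapes B x y v → Escapes B⁺ x y v
  Escapes⇒Escapes⁺ x→y (w , v~w , w∈y , w∉x) =
    w , v~w , B⊆B⁺ w∈y , λ w∈x⁺ → w∉x (B⁺∩B-child⊆B x→y w∈x⁺ w∈y)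

  B⁺-slick : Slick G T r B → Slick G T r B⁺
  B⁺-slick slick x y x→y v v∈x v∈y with B⁺-cases v∈y
  ... | inj₁ v∈By =
        Escapes⇒Escapes⁺ x→y (slick x y x→y v (B⁺∩B-child⊆B x→y v∈x v∈By) v∈By)
  ... | inj₂ (x′ , x′→y , _ , escapes) rewrite parent-unique x′→y x→y =
        Escapes⇒Escapes⁺ x→y escapes

lemma30 : (G T : Graph) → IsTree T → (B : Bags G T) → (k : ℕ)
  → IsWeakTreeDecomposition G T B → HasWidth G T B k
  → (r : Fin (n T))
  → Σ (Bags G T) (λ B′ → IsTreeDecomposition G T B′
      × WidthAtMost G T B′ (2 * k + 1)
      × (Slick G T r B → Slick G T r B′))
lemma30 G T tree B k weak width r =
  B⁺ , (B⁺-covers , B⁺-subtree) , B⁺-width (proj₁ width) , B⁺-slick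
  where open Strengthening G T tree B weak r
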